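{- For every MV-algebra $A$, $\widehat{A/\mathrm{Rad}(A)}\cong\widehat A$, where $\mathrm{Rad}(A)$ is the intersection of all maximal ideals of $A$.
   Context: The profinite completion $\widehat A$ of an MV-algebra $A$ is the inverse limit of the finite quotients $A/I$, $I$ ranging over ideals of $A$ with $A/I$ finite, directed by reverse inclusion, with natural quotient maps. -}

module Defs where

open import Level using (Level; _⊔_; suc)
open import Data.Nat using (ℕ)
open import Data.Fin using (Fin)
open import Data.Product using (Σ; ∃; _×_)
open import Relation.Nullary using (¬_)
open import Relation.Binary.PropositionalEquality using (_≡_)
open import Relation.Binary.Structures using (IsEquivalence)

record MVStructure (c ℓ : Level) : Set (suc (c ⊔ ℓ)) where
  infixl 6 _⊕_ _⊙_
  field
    Carrier : Set c
    _≈_     : Carrier → Carrier → Set ℓ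
    _⊕_     : Carrier → Carrier → Carrier
    neg     : Carrier → Carrier
    𝟘       : Carrier

  𝟙 : Carrier
  𝟙 = neg 𝟘

  _⊙_ : Carrier → Carrier → Carrier
  x ⊙ y = neg (neg x ⊕ neg y)

  _≤_ : Carrier → Carrier → Set ℓ
  x ≤ y = (neg x ⊕ y) ≈ 𝟙

  dist : Carrier → Carrier → Carrier
  dist x y = (x ⊙ neg y) ⊕ (neg x ⊙ y)

record IsMVAlgebra {c ℓ} (S : MVStructure c ℓ) : Set (c ⊔ ℓ) where
  open MVStructure S
  field
    isEquivalence : IsEquivalence _≈_
    ⊕-cong   : ∀ {x x' y y'} → x ≈ x' → y ≈ y' → (x ⊕ y) ≈ (x' ⊕ y')
    neg-cong : ∀ {x x'} → x ≈ x' → neg x ≈ neg x'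
    ⊕-assoc  : ∀ x y z → ((x ⊕ y) ⊕ z) ≈ (x ⊕ (y ⊕ z))
    ⊕-comm   : ∀ x y → (x ⊕ y) ≈ (y ⊕ x)
    ⊕-identity : ∀ x → (x ⊕ 𝟘) ≈ x
    neg-involutive : ∀ x → neg (neg x) ≈ x
    ⊕-absorb : ∀ x → (x ⊕ 𝟙) ≈ 𝟙
    łukasiewicz : ∀ x y → (neg (neg x ⊕ y) ⊕ y) ≈ (neg (neg y ⊕ x) ⊕ x)

record MVAlgebra (c ℓ : Level) : Set (suc (c ⊔ ℓ)) where
  field
    structure : MVStructure c ℓ
    isMVAlgebra : IsMVAlgebra structure
  open MVStructure structure public

module _ {c ℓ} (S : MVStructure c ℓ) where
  open MVStructure S

  record Ideal : Set (c ⊔ suc ℓ) where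
    field
      mem     : Carrier → Set ℓ
      𝟘∈      : mem 𝟘
      ⊕-closed : ∀ x y → mem x → mem y → mem (x ⊕ y)
      ↓-closed : ∀ x y → y ≤ x → mem x → mem y
  open Ideal public

  _⊆ᴵ_ : Ideal → Ideal → Set (c ⊔ ℓ)
  I ⊆ᴵ J = ∀ x → mem I x → mem J x

  Proper : Ideal → Set ℓ
  Proper I = ¬ mem I 𝟙

  Maximal : Ideal → Set (c ⊔ suc ℓ)
  Maximal I = Proper I × (∀ J → Proper J → I ⊆ᴵ J → J ⊆ᴵ I)

  Rad : Carrier → Set (c ⊔ suc ℓ)
  Rad x = ∀ (M : Ideal) → Maximal M → mem M x

  _~[_]_ : Carrier → Ideal → Carrier → Set ℓ
  x ~[ I ] y = mem I (dist x y)

  FiniteQuotient : Ideal → Set (c ⊔ ℓ)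
  FiniteQuotient I = Σ ℕ λ n → Σ (Fin n → Carrier) λ f →
    (∀ x → ∃ λ i → f i ~[ I ] x) × (∀ i j → f i ~[ I ] f j → i ≡ j)

  FinIdeal : Set (c ⊔ suc ℓ)
  FinIdeal = Σ Ideal FiniteQuotient

  ideal : FinIdeal → Ideal
  ideal = Data.Product.proj₁

  -- Elements of the inverse limit of the A/I (I with A/I finite), directed by
  -- reverse inclusion; the component at I is represented by an element of A.
  record Profinite : Set (c ⊔ suc ℓ) where
    field
      fam    : FinIdeal → Carrier
      compat : ∀ I J → ideal I ⊆ᴵ ideal J → fam I ~[ ideal J ] fam J
  open Profinite public

  _≈̂_ : Profinite → Profinite → Set (c ⊔ suc ℓ)
  x ≈̂ y = ∀ I → fam x I ~[ ideal I ] fam y I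

  -- graphs of the componentwise MV-operations of the inverse limit
  IsSum : Profinite → Profinite → Profinite → Set (c ⊔ suc ℓ)
  IsSum x y z = ∀ I → fam z I ~[ ideal I ] (fam x I ⊕ fam y I)

  IsNeg : Profinite → Profinite → Set (c ⊔ suc ℓ)
  IsNeg x z = ∀ I → fam z I ~[ ideal I ] neg (fam x I)

  IsZero : Profinite → Set (c ⊔ suc ℓ)
  IsZero z = ∀ I → fam z I ~[ ideal I ] 𝟘

_/Rad : ∀ {c ℓ} → MVAlgebra c ℓ → MVStructure c (c ⊔ suc ℓ)
A /Rad = record
  { Carrier = Carrier
  ; _≈_ = λ x y → Rad structure (dist x y)
  ; _⊕_ = _⊕_
  ; neg = neg
  ; 𝟘 = 𝟘
  }
  where open MVAlgebra A

record ProfiniteIso {c ℓ c' ℓ'} (S : MVStructure c ℓ) (T : MVStructure c' ℓ')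
       : Set (c ⊔ suc ℓ ⊔ c' ⊔ suc ℓ') where
  field
    to         : Profinite S → Profinite T
    to-cong    : ∀ x y → _≈̂_ S x y → _≈̂_ T (to x) (to y)
    injective  : ∀ x y → _≈̂_ T (to x) (to y) → _≈̂_ S x y
    surjective : ∀ y → ∃ λ x → _≈̂_ T (to x) y
    pres-⊕     : ∀ x y z → IsSum S x y z → IsSum T (to x) (to y) (to z)
    pres-neg   : ∀ x z → IsNeg S x z → IsNeg T (to x) (to z)
    pres-𝟘     : ∀ z → IsZero S z → IsZero T (to z)

-- Every ideal I with A/I finite contains Rad(A).  Given x ∉ I, exhaustive search in the finite
-- algebra A/I yields an idempotent u maximal among idempotents not above x.  Its principal ideal
-- ↓u is maximal: a proper ideal containing some y ⋠ u also contains an idempotent multiple v of y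
-- (pigeonhole) with v ⋠ u and neg v ⋠ u, so maximality of u gives x ≼ u ⊕ v and x ≼ u ⊕ neg v,
-- which for idempotent v force x ≼ u.  Pulling ↓u back to A gives a maximal ideal missing x.
-- Hence A and A/Rad(A) have the same ideals with finite quotient, with the same quotients, so
-- their profinite completions agree componentwise.
module Submission where

open import Defs
open import Level using (_⊔_; Lift; lift; lower) renaming (suc to lsuc)
open import Data.Nat as ℕ using (ℕ; zero; suc)
import Data.Nat.Properties as ℕ
open import Data.Fin as Fin using (Fin; zero; suc; toℕ)
open import Data.Fin.Properties using (pigeonhole)
open import Data.Product using (Σ; ∃; _×_; _,_; proj₁; proj₂)
open import Data.Empty using (⊥-elim)
open import Function using (_∘_)
open import Relation.Nullary using (¬_; Dec; yes; no)
open import Relation.Nullary.Decidable using (map′)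
open import Relation.Unary using (Decidable)
open import Relation.Binary.PropositionalEquality using (_≡_; refl; cong)
open import Relation.Binary.Structures using (IsEquivalence)
open import Relation.Binary.Bundles using (Setoid)
import Relation.Binary.Reasoning.Setoid as SetoidReasoning
open import Algebra.Bundles using (CommutativeSemigroup)
import Algebra.Properties.CommutativeSemigroup as CommutativeSemigroupProperties

module MVProperties {c ℓ} (A : MVAlgebra c ℓ) where
  open MVAlgebra A public renaming (_≈_ to infix 4 _≈_; _≤_ to infix 4 _≤_)
  open IsMVAlgebra isMVAlgebra public
  open IsEquivalence isEquivalence public
    renaming (refl to ≈-refl; reflexive to ≈-reflexive; sym to ≈-sym; trans to ≈-trans)

  setoid : Setoid c ℓ
  setoid = record { isEquivalence = isEquivalence }

  ⊕-identityˡ : ∀ x → 𝟘 ⊕ x ≈ x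
  ⊕-identityˡ x = ≈-trans (⊕-comm 𝟘 x) (⊕-identity x)

  ⊕-commutativeSemigroup : CommutativeSemigroup c ℓ
  ⊕-commutativeSemigroup = record
    { _∙_ = _⊕_
    ; isCommutativeSemigroup = record
      { isSemigroup = record
        { isMagma = record { isEquivalence = isEquivalence ; ∙-cong = ⊕-cong }
        ; assoc = ⊕-assoc }
      ; comm = ⊕-comm } }

  open CommutativeSemigroupProperties ⊕-commutativeSemigroup
    using (xy∙z≈xz∙y) renaming (interchange to ⊕-interchange)
  open SetoidReasoning setoid public

  ⊕-congˡ : ∀ {x y y'} → y ≈ y' → x ⊕ y ≈ x ⊕ y'
  ⊕-congˡ = ⊕-cong ≈-refl

  ⊕-congʳ : ∀ {x x' y} → x ≈ x' → x ⊕ y ≈ x' ⊕ y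
  ⊕-congʳ p = ⊕-cong p ≈-refl

  neg-𝟙 : neg 𝟙 ≈ 𝟘
  neg-𝟙 = neg-involutive 𝟘

  ⊕-zeroˡ : ∀ x → 𝟙 ⊕ x ≈ 𝟙
  ⊕-zeroˡ x = ≈-trans (⊕-comm 𝟙 x) (⊕-absorb x)

  ⊕-inverseˡ : ∀ x → neg x ⊕ x ≈ 𝟙
  ⊕-inverseˡ x = begin
    neg x ⊕ x            ≈⟨ ⊕-congʳ (neg-cong (≈-sym (≈-trans (⊕-congʳ neg-𝟙) (⊕-identityˡ x)))) ⟩
    neg (neg 𝟙 ⊕ x) ⊕ x  ≈⟨ ≈-sym (łukasiewicz x 𝟙) ⟩
    neg (neg x ⊕ 𝟙) ⊕ 𝟙  ≈⟨ ⊕-absorb _ ⟩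
    𝟙                    ∎

  ⊕-inverseʳ : ∀ x → x ⊕ neg x ≈ 𝟙
  ⊕-inverseʳ x = ≈-trans (⊕-comm x (neg x)) (⊕-inverseˡ x)

  infix 4 _≼_
  _≼_ : Carrier → Carrier → Set (c ⊔ ℓ)
  x ≼ y = ∃ λ z → x ⊕ z ≈ y

  ≤⇒≼ : ∀ {x y} → x ≤ y → x ≼ y
  ≤⇒≼ {x} {y} x≤y = neg (neg y ⊕ x) , (begin
    x ⊕ neg (neg y ⊕ x)  ≈⟨ ⊕-comm _ _ ⟩
    neg (neg y ⊕ x) ⊕ x  ≈⟨ ≈-sym (łukasiewicz x y) ⟩
    neg (neg x ⊕ y) ⊕ y  ≈⟨ ⊕-congʳ (≈-trans (neg-cong x≤y) neg-𝟙) ⟩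
    𝟘 ⊕ y                ≈⟨ ⊕-identityˡ y ⟩
    y                    ∎)

  ≼⇒≤ : ∀ {x y} → x ≼ y → x ≤ y
  ≼⇒≤ {x} {y} (z , x⊕z≈y) = begin
    neg x ⊕ y        ≈⟨ ⊕-congˡ (≈-sym x⊕z≈y) ⟩
    neg x ⊕ (x ⊕ z)  ≈⟨ ≈-sym (⊕-assoc _ _ _) ⟩
    (neg x ⊕ x) ⊕ z  ≈⟨ ⊕-congʳ (⊕-inverseˡ x) ⟩
    𝟙 ⊕ z            ≈⟨ ⊕-zeroˡ z ⟩
    𝟙                ∎

  ≼-reflexive : ∀ {x y} → x ≈ y → x ≼ y
  ≼-reflexive {x} x≈y = 𝟘 , ≈-trans (⊕-identity x) x≈y

  ≼-refl : ∀ {x} → x ≼ x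
  ≼-refl = ≼-reflexive ≈-refl

  ≼-trans : ∀ {x y z} → x ≼ y → y ≼ z → x ≼ z
  ≼-trans {x} (a , p) (b , q) = a ⊕ b , ≈-trans (≈-sym (⊕-assoc x a b)) (≈-trans (⊕-congʳ p) q)

  ≼-respʳ-≈ : ∀ {x y y'} → y ≈ y' → x ≼ y → x ≼ y'
  ≼-respʳ-≈ y≈y' (a , p) = a , ≈-trans p y≈y'

  ≼-respˡ-≈ : ∀ {x x' y} → x ≈ x' → x ≼ y → x' ≼ y
  ≼-respˡ-≈ x≈x' (a , p) = a , ≈-trans (⊕-congʳ (≈-sym x≈x')) p

  x≼x⊕y : ∀ x y → x ≼ x ⊕ y
  x≼x⊕y x y = y , ≈-refl

  y≼x⊕y : ∀ x y → y ≼ x ⊕ y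
  y≼x⊕y x y = x , ⊕-comm y x

  ≼-minimum : ∀ x → 𝟘 ≼ x
  ≼-minimum x = x , ⊕-identityˡ x

  ≼-maximum : ∀ x → x ≼ 𝟙
  ≼-maximum x = neg x , ⊕-inverseʳ x

  ⊕-monoˡ-≼ : ∀ {x y} w → x ≼ y → x ⊕ w ≼ y ⊕ w
  ⊕-monoˡ-≼ {x} {y} w (a , x⊕a≈y) = a , (begin
    (x ⊕ w) ⊕ a  ≈⟨ xy∙z≈xz∙y x w a ⟩
    (x ⊕ a) ⊕ w  ≈⟨ ⊕-congʳ x⊕a≈y ⟩
    y ⊕ w        ∎)

  ⊕-mono-≼ : ∀ {x x' y y'} → x ≼ x' → y ≼ y' → x ⊕ y ≼ x' ⊕ y'
  ⊕-mono-≼ {x} {x'} {y} {y'} x≼x' y≼y' = ≼-trans (⊕-monoˡ-≼ y x≼x')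
    (≼-respˡ-≈ (⊕-comm y x') (≼-respʳ-≈ (⊕-comm y' x') (⊕-monoˡ-≼ x' y≼y')))

  neg-antimono-≼ : ∀ {x y} → x ≼ y → neg y ≼ neg x
  neg-antimono-≼ {x} {y} x≼y =
    ≤⇒≼ (≈-trans (⊕-congʳ (neg-involutive y)) (≈-trans (⊕-comm y (neg x)) (≼⇒≤ x≼y)))

  ≼-antisym : ∀ {x y} → x ≼ y → y ≼ x → x ≈ y
  ≼-antisym {x} {y} x≼y y≼x = ≈-sym (begin
    y                    ≈⟨ ≈-sym (⊕-identity y) ⟩
    y ⊕ 𝟘                ≈⟨ ⊕-congˡ (≈-sym (≈-trans (neg-cong (≼⇒≤ x≼y)) neg-𝟙)) ⟩
    y ⊕ neg (neg x ⊕ y)  ≈⟨ proj₂ (≤⇒≼ (≼⇒≤ y≼x)) ⟩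
    x                    ∎)

  infixl 7 _⊖_
  _⊖_ : Carrier → Carrier → Carrier
  x ⊖ y = x ⊙ neg y

  ⊙-cong : ∀ {x x' y y'} → x ≈ x' → y ≈ y' → x ⊙ y ≈ x' ⊙ y'
  ⊙-cong p q = neg-cong (⊕-cong (neg-cong p) (neg-cong q))

  ⊙-comm : ∀ x y → x ⊙ y ≈ y ⊙ x
  ⊙-comm x y = neg-cong (⊕-comm _ _)

  ⊙-monoˡ-≼ : ∀ {x y} w → x ≼ y → x ⊙ w ≼ y ⊙ w
  ⊙-monoˡ-≼ w x≼y = neg-antimono-≼ (⊕-monoˡ-≼ (neg w) (neg-antimono-≼ x≼y))

  x⊖x≈𝟘 : ∀ x → x ⊖ x ≈ 𝟘
  x⊖x≈𝟘 x = ≈-trans (neg-cong (≈-trans (⊕-congˡ (neg-involutive x)) (⊕-inverseˡ x))) neg-𝟙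

  x≼y⊕[x⊖y] : ∀ x y → x ≼ y ⊕ (x ⊖ y)
  x≼y⊕[x⊖y] x y = neg (neg y ⊕ x) , (begin
    x ⊕ neg (neg y ⊕ x)        ≈⟨ ⊕-comm _ _ ⟩
    neg (neg y ⊕ x) ⊕ x        ≈⟨ ≈-sym (łukasiewicz x y) ⟩
    neg (neg x ⊕ y) ⊕ y        ≈⟨ ⊕-comm _ _ ⟩
    y ⊕ neg (neg x ⊕ y)        ≈⟨ ⊕-congˡ (neg-cong (⊕-congˡ (≈-sym (neg-involutive y)))) ⟩
    y ⊕ (x ⊖ y)                ∎)

  [x⊕y]⊙z≼x⊕[y⊙z] : ∀ x y z → (x ⊕ y) ⊙ z ≼ x ⊕ (y ⊙ z)
  [x⊕y]⊙z≼x⊕[y⊙z] x y z = ≤⇒≼ (begin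
    neg ((x ⊕ y) ⊙ z) ⊕ (x ⊕ (y ⊙ z))   ≈⟨ ⊕-congʳ (neg-involutive _) ⟩
    (a ⊕ neg z) ⊕ (x ⊕ (y ⊙ z))         ≈⟨ ⊕-interchange a (neg z) x (y ⊙ z) ⟩
    (a ⊕ x) ⊕ (neg z ⊕ (y ⊙ z))         ≈⟨ ⊕-congˡ łukasiewicz-⊙ ⟩
    (a ⊕ x) ⊕ (y ⊕ b)                   ≈⟨ ≈-trans (≈-sym (⊕-assoc _ _ _)) (⊕-congʳ (⊕-assoc a x y)) ⟩
    (a ⊕ (x ⊕ y)) ⊕ b                   ≈⟨ ⊕-congʳ (⊕-inverseˡ _) ⟩
    𝟙 ⊕ b                               ≈⟨ ⊕-zeroˡ b ⟩
    𝟙                                   ∎)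
    where
    a b : Carrier
    a = neg (x ⊕ y)
    b = neg (y ⊕ z)
    łukasiewicz-⊙ : neg z ⊕ (y ⊙ z) ≈ y ⊕ b
    łukasiewicz-⊙ = begin
      neg z ⊕ (y ⊙ z)                 ≈⟨ ⊕-comm _ _ ⟩
      neg (neg y ⊕ neg z) ⊕ neg z     ≈⟨ łukasiewicz y (neg z) ⟩
      neg (neg (neg z) ⊕ y) ⊕ y       ≈⟨ ⊕-congʳ (neg-cong (⊕-congʳ (neg-involutive z))) ⟩
      neg (z ⊕ y) ⊕ y                 ≈⟨ ⊕-comm _ _ ⟩
      y ⊕ neg (z ⊕ y)                 ≈⟨ ⊕-congˡ (neg-cong (⊕-comm z y)) ⟩
      y ⊕ b                           ∎

  ⊖-triangle : ∀ x y z → x ⊖ z ≼ (x ⊖ y) ⊕ (y ⊖ z)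
  ⊖-triangle x y z = ≼-trans (⊙-monoˡ-≼ (neg z) (x≼y⊕[x⊖y] x y))
    (≼-respˡ-≈ (⊙-cong (⊕-comm (x ⊖ y) y) ≈-refl) ([x⊕y]⊙z≼x⊕[y⊙z] (x ⊖ y) y (neg z)))

  [x⊕w]⊖[y⊕w]≼x⊖y : ∀ x y w → (x ⊕ w) ⊖ (y ⊕ w) ≼ x ⊖ y
  [x⊕w]⊖[y⊕w]≼x⊖y x y w = ≼-trans (⊙-monoˡ-≼ (neg (y ⊕ w)) x⊕w≼[x⊖y]⊕[y⊕w])
    (≼-trans ([x⊕y]⊙z≼x⊕[y⊙z] (x ⊖ y) (y ⊕ w) (neg (y ⊕ w)))
      (≼-reflexive (≈-trans (⊕-congˡ (x⊖x≈𝟘 _)) (⊕-identity _))))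
    where
    x⊕w≼[x⊖y]⊕[y⊕w] : x ⊕ w ≼ (x ⊖ y) ⊕ (y ⊕ w)
    x⊕w≼[x⊖y]⊕[y⊕w] = ≼-respʳ-≈ (≈-trans (⊕-congʳ (⊕-comm y (x ⊖ y))) (⊕-assoc _ _ _))
      (⊕-monoˡ-≼ w (x≼y⊕[x⊖y] x y))

  dist-⊖ : ∀ x y → dist x y ≈ (x ⊖ y) ⊕ (y ⊖ x)
  dist-⊖ x y = ⊕-congˡ (⊙-comm (neg x) y)

  dist-sym : ∀ x y → dist x y ≈ dist y x
  dist-sym x y = ≈-trans (dist-⊖ x y) (≈-trans (⊕-comm _ _) (≈-sym (dist-⊖ y x)))

  dist-cong : ∀ {x x' y y'} → x ≈ x' → y ≈ y' → dist x y ≈ dist x' y'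
  dist-cong p q = ⊕-cong (⊙-cong p (neg-cong q)) (⊙-cong (neg-cong p) q)

  dist-self : ∀ x → dist x x ≈ 𝟘
  dist-self x = ≈-trans (dist-⊖ x x) (≈-trans (⊕-cong (x⊖x≈𝟘 x) (x⊖x≈𝟘 x)) (⊕-identity 𝟘))

  dist-𝟘 : ∀ x → dist x 𝟘 ≈ x
  dist-𝟘 x = ≈-trans (⊕-cong x⊖𝟘≈x neg-x⊙𝟘≈𝟘) (⊕-identity x)
    where
    x⊖𝟘≈x : x ⊖ 𝟘 ≈ x
    x⊖𝟘≈x = ≈-trans (neg-cong (≈-trans (⊕-congˡ neg-𝟙) (⊕-identity _))) (neg-involutive x)
    neg-x⊙𝟘≈𝟘 : neg x ⊙ 𝟘 ≈ 𝟘
    neg-x⊙𝟘≈𝟘 = ≈-trans (neg-cong (⊕-absorb _)) neg-𝟙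

  dist-triangle : ∀ x y z → dist x z ≼ dist x y ⊕ dist y z
  dist-triangle x y z = ≼-respˡ-≈ (≈-sym (dist-⊖ x z))
    (≼-respʳ-≈ regroup (⊕-mono-≼ (⊖-triangle x y z) (⊖-triangle z y x)))
    where
    regroup : ((x ⊖ y) ⊕ (y ⊖ z)) ⊕ ((z ⊖ y) ⊕ (y ⊖ x)) ≈ dist x y ⊕ dist y z
    regroup = ≈-trans
      (≈-trans (⊕-congˡ (⊕-comm _ _)) (⊕-interchange (x ⊖ y) (y ⊖ z) (y ⊖ x) (z ⊖ y)))
      (≈-sym (⊕-cong (dist-⊖ x y) (dist-⊖ y z)))

  dist-⊕ʳ : ∀ x y w → dist (x ⊕ w) (y ⊕ w) ≼ dist x y
  dist-⊕ʳ x y w = ≼-respˡ-≈ (≈-sym (dist-⊖ _ _)) (≼-respʳ-≈ (≈-sym (dist-⊖ x y))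
    (⊕-mono-≼ ([x⊕w]⊖[y⊕w]≼x⊖y x y w) ([x⊕w]⊖[y⊕w]≼x⊖y y x w)))

  dist-neg : ∀ x y → dist (neg x) (neg y) ≈ dist x y
  dist-neg x y = ≈-trans
    (⊕-cong (⊙-cong ≈-refl (neg-involutive y)) (⊙-cong (neg-involutive x) ≈-refl)) (⊕-comm _ _)

  infixr 8 _·_
  _·_ : ℕ → Carrier → Carrier
  zero  · y = 𝟘
  suc k · y = k · y ⊕ y

  ·-monoˡ-≼ : ∀ {k m} y → k ℕ.≤ m → k · y ≼ m · y
  ·-monoˡ-≼ y ℕ.z≤n       = ≼-minimum _
  ·-monoˡ-≼ y (ℕ.s≤s k≤m) = ⊕-monoˡ-≼ y (·-monoˡ-≼ y k≤m)

  ⊕-absorbs-· : ∀ {w y} → w ⊕ y ≈ w → ∀ k → w ⊕ k · y ≈ w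
  ⊕-absorbs-· {w} w⊕y≈w zero    = ⊕-identity w
  ⊕-absorbs-· {w} w⊕y≈w (suc k) =
    ≈-trans (≈-sym (⊕-assoc _ _ _)) (≈-trans (⊕-congʳ (⊕-absorbs-· w⊕y≈w k)) w⊕y≈w)

  Idempotent : Carrier → Set ℓ
  Idempotent v = v ⊕ v ≈ v

  Idempotent-⊕ : ∀ {u v} → Idempotent u → Idempotent v → Idempotent (u ⊕ v)
  Idempotent-⊕ {u} {v} idem-u idem-v = ≈-trans (⊕-interchange u v u v) (⊕-cong idem-u idem-v)

  Idempotent-neg : ∀ {v} → Idempotent v → Idempotent (neg v)
  Idempotent-neg {v} idem-v = ≼-antisym (≤⇒≼ (begin
    neg (neg v ⊕ neg v) ⊕ neg v  ≈⟨ łukasiewicz v (neg v) ⟩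
    neg (neg (neg v) ⊕ v) ⊕ v    ≈⟨ ⊕-congʳ (neg-cong (≈-trans (⊕-congʳ (neg-involutive v)) idem-v)) ⟩
    neg v ⊕ v                    ≈⟨ ⊕-inverseˡ v ⟩
    𝟙                            ∎)) (x≼x⊕y _ _)

  -- neg z ⊕ u lies above v and becomes 𝟙 when v is added; for idempotent v adding it changes nothing.
  ≼-idempotent-cases : ∀ {z u v} → Idempotent v → z ≼ u ⊕ v → z ≼ u ⊕ neg v → z ≼ u
  ≼-idempotent-cases {z} {u} {v} idem-v z≼u⊕v z≼u⊕¬v = ≤⇒≼ (begin
    a            ≈⟨ ≈-sym v⊕t≈a ⟩
    v ⊕ t        ≈⟨ ⊕-congʳ (≈-sym idem-v) ⟩
    (v ⊕ v) ⊕ t  ≈⟨ xy∙z≈xz∙y v v t ⟩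
    (v ⊕ t) ⊕ v  ≈⟨ ⊕-congʳ v⊕t≈a ⟩
    a ⊕ v        ≈⟨ ≈-trans (⊕-assoc _ _ _) (≼⇒≤ z≼u⊕v) ⟩
    𝟙            ∎)
    where
    a : Carrier
    a = neg z ⊕ u
    v≼a : v ≼ a
    v≼a = ≤⇒≼ (≈-trans (⊕-comm _ _) (≈-trans (⊕-assoc _ _ _) (≼⇒≤ z≼u⊕¬v)))
    t : Carrier
    t = proj₁ v≼a
    v⊕t≈a : v ⊕ t ≈ a
    v⊕t≈a = proj₂ v≼a

  record IsIdeal {p} (J : Carrier → Set p) : Set (c ⊔ ℓ ⊔ p) where
    field
      z∈ : J 𝟘
      ⊕∈ : ∀ {x y} → J x → J y → J (x ⊕ y)
      ↓∈ : ∀ {x y} → y ≼ x → J x → J y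

    ∈-resp-≈ : ∀ {x y} → x ≈ y → J x → J y
    ∈-resp-≈ x≈y = ↓∈ (≼-reflexive (≈-sym x≈y))

    ·∈ : ∀ {y} k → J y → J (k · y)
    ·∈ zero    _  = z∈
    ·∈ (suc k) jy = ⊕∈ (·∈ k jy) jy

  module Quotient {p} {J : Carrier → Set p} (isIdeal : IsIdeal J) where
    open IsIdeal isIdeal

    infix 4 _~_
    _~_ : Carrier → Carrier → Set p
    x ~ y = J (dist x y)

    ~-refl : ∀ {x} → x ~ x
    ~-refl {x} = ∈-resp-≈ (≈-sym (dist-self x)) z∈

    ~-sym : ∀ {x y} → x ~ y → y ~ x
    ~-sym {x} {y} = ∈-resp-≈ (dist-sym x y)

    ~-trans : ∀ {x y z} → x ~ y → y ~ z → x ~ z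
    ~-trans {x} {y} {z} x~y y~z = ↓∈ (dist-triangle x y z) (⊕∈ x~y y~z)

    ≈⇒~ : ∀ {x y} → x ≈ y → x ~ y
    ≈⇒~ {x} x≈y = ∈-resp-≈ (≈-trans (≈-sym (dist-self x)) (dist-cong ≈-refl x≈y)) z∈

    ~-⊕ : ∀ {x x' y y'} → x ~ x' → y ~ y' → x ⊕ y ~ x' ⊕ y'
    ~-⊕ {x} {x'} {y} {y'} x~x' y~y' = ~-trans (↓∈ (dist-⊕ʳ x x' y) x~x')
      (↓∈ (≼-respˡ-≈ (dist-cong (⊕-comm y x') (⊕-comm y' x')) (dist-⊕ʳ y y' x')) y~y')

    ~-neg : ∀ {x y} → x ~ y → neg x ~ neg y
    ~-neg {x} {y} = ∈-resp-≈ (≈-sym (dist-neg x y))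

    ∈⇒~𝟘 : ∀ {x} → J x → x ~ 𝟘
    ∈⇒~𝟘 {x} = ∈-resp-≈ (≈-sym (dist-𝟘 x))

    ~𝟘⇒∈ : ∀ {x} → x ~ 𝟘 → J x
    ~𝟘⇒∈ {x} = ∈-resp-≈ (dist-𝟘 x)

    quotient : MVAlgebra c p
    quotient = record
      { structure = record { Carrier = Carrier ; _≈_ = _~_ ; _⊕_ = _⊕_ ; neg = neg ; 𝟘 = 𝟘 }
      ; isMVAlgebra = record
        { isEquivalence  = record { refl = ~-refl ; sym = ~-sym ; trans = ~-trans }
        ; ⊕-cong         = ~-⊕
        ; neg-cong       = ~-neg
        ; ⊕-assoc        = λ x y z → ≈⇒~ (⊕-assoc x y z)
        ; ⊕-comm         = λ x y → ≈⇒~ (⊕-comm x y)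
        ; ⊕-identity     = λ x → ≈⇒~ (⊕-identity x)
        ; neg-involutive = λ x → ≈⇒~ (neg-involutive x)
        ; ⊕-absorb       = λ x → ≈⇒~ (⊕-absorb x)
        ; łukasiewicz    = λ x y → ≈⇒~ (łukasiewicz x y) } }

module FiniteMVProperties {c p} (B : MVAlgebra c p) (n : ℕ) (f : Fin n → MVAlgebra.Carrier B)
  (f-surjective : ∀ x → ∃ λ i → MVAlgebra._≈_ B (f i) x)
  (f-injective : ∀ i j → MVAlgebra._≈_ B (f i) (f j) → i ≡ j) where
  open MVProperties B

  index : Carrier → Fin n
  index x = proj₁ (f-surjective x)

  f-index : ∀ x → f (index x) ≈ x
  f-index x = proj₂ (f-surjective x)

  index-injective : ∀ {x y} → index x ≡ index y → x ≈ y
  index-injective {x} {y} eq =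
    ≈-trans (≈-sym (f-index x)) (≈-trans (≈-reflexive (cong f eq)) (f-index y))

  index-cong : ∀ {x y} → x ≈ y → index x ≡ index y
  index-cong {x} {y} x≈y = f-injective _ _ (≈-trans (f-index x) (≈-trans x≈y (≈-sym (f-index y))))

  infix 4 _≟_ _≼?_
  _≟_ : ∀ x y → Dec (x ≈ y)
  x ≟ y = map′ index-injective index-cong (index x Fin.≟ index y)

  _≼?_ : ∀ x y → Dec (x ≼ y)
  x ≼? y = map′ ≤⇒≼ ≼⇒≤ (neg x ⊕ y ≟ 𝟙)

  -- Pigeonhole on the n + 1 multiples 0 · y, …, n · y.
  multiples-stabilise : ∀ y → ∃ λ k → k · y ⊕ y ≈ k · y
  multiples-stabilise y with pigeonhole (ℕ.n<1+n n) (λ (i : Fin (suc n)) → index (toℕ i · y))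
  ... | i , j , i<j , same-index =
    toℕ i , ≼-antisym (≼-trans (·-monoˡ-≼ y i<j) (≼-reflexive (≈-sym (index-injective same-index))))
                      (x≼x⊕y _ _)

  idempotent-multiple : ∀ y → ∃ λ k → Idempotent (k · y) × y ≼ k · y
  idempotent-multiple y with multiples-stabilise y
  ... | k , stable = k , ⊕-absorbs-· stable k , ≼-respʳ-≈ stable (y≼x⊕y (k · y) y)

  module _ {q} (P : Carrier → Set q) (P? : Decidable P) where

    maximal-among : ∀ k (g : Fin k → Carrier) {b} → P b →
                    ∃ λ m → P m × b ≼ m × (∀ i → P (g i) → m ≼ g i → g i ≼ m)
    maximal-among zero    g {b} Pb = b , Pb , ≼-refl , λ ()
    maximal-among (suc k) g {b} Pb with P? (g zero) | b ≼? g zero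
    ... | yes Pg | yes b≼g =
      let m , Pm , g≼m , m-max = maximal-among k (λ i → g (suc i)) Pg in
      m , Pm , ≼-trans b≼g g≼m , λ { zero _ _ → g≼m ; (suc i) → m-max i }
    ... | yes Pg | no b⋠g =
      let m , Pm , b≼m , m-max = maximal-among k (λ i → g (suc i)) Pb in
      m , Pm , b≼m , λ { zero _ m≼g → ⊥-elim (b⋠g (≼-trans b≼m m≼g)) ; (suc i) → m-max i }
    ... | no ¬Pg | _ =
      let m , Pm , b≼m , m-max = maximal-among k (λ i → g (suc i)) Pb in
      m , Pm , b≼m , λ { zero Pg _ → ⊥-elim (¬Pg Pg) ; (suc i) → m-max i }

    maximal-above : (∀ {x y} → x ≈ y → P x → P y) →
                    ∀ {b} → P b → ∃ λ m → P m × b ≼ m × (∀ w → P w → m ≼ w → w ≼ m)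
    maximal-above P-resp Pb with maximal-among n f Pb
    ... | m , Pm , b≼m , m-max = m , Pm , b≼m , λ w Pw m≼w →
      ≼-respˡ-≈ (f-index w)
        (m-max (index w) (P-resp (≈-sym (f-index w)) Pw) (≼-respʳ-≈ (≈-sym (f-index w)) m≼w))

  Avoids : Carrier → Carrier → Set (c ⊔ p)
  Avoids z w = Idempotent w × ¬ z ≼ w

  Avoids? : ∀ z → Decidable (Avoids z)
  Avoids? z w with w ⊕ w ≟ w | z ≼? w
  ... | yes idem | no z⋠w  = yes (idem , z⋠w)
  ... | yes _    | yes z≼w = no (λ (_ , z⋠w) → z⋠w z≼w)
  ... | no ¬idem | _       = no (λ (idem , _) → ¬idem idem)

  Avoids-resp : ∀ {z x y} → x ≈ y → Avoids z x → Avoids z y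
  Avoids-resp x≈y (idem , z⋠x) =
    ≈-trans (⊕-cong (≈-sym x≈y) (≈-sym x≈y)) (≈-trans idem x≈y) ,
    λ z≼y → z⋠x (≼-respʳ-≈ (≈-sym x≈y) z≼y)

  ↓-Maximal : Carrier → Set (c ⊔ lsuc p)
  ↓-Maximal u = ∀ (J : Carrier → Set p) → IsIdeal J → ¬ J 𝟙 →
                (∀ x → x ≼ u → J x) → ∀ y → J y → y ≼ u

  maximal-principal-ideal-avoiding : ∀ {z} → ¬ z ≈ 𝟘 →
                                     ∃ λ u → Idempotent u × ¬ z ≼ u × ↓-Maximal u
  maximal-principal-ideal-avoiding {z} z≉𝟘
    with maximal-above (Avoids z) (Avoids? z) Avoids-resp {𝟘}
                       (⊕-identity 𝟘 , λ z≼𝟘 → z≉𝟘 (≼-antisym z≼𝟘 (≼-minimum z)))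
  ... | u , (idem-u , z⋠u) , _ , u-max = u , idem-u , z⋠u , ↓u-maximal
    where
    z≼u⊕ : ∀ {w} → Idempotent w → ¬ w ≼ u → z ≼ u ⊕ w
    z≼u⊕ {w} idem-w w⋠u with z ≼? u ⊕ w
    ... | yes z≼u⊕w = z≼u⊕w
    ... | no z⋠u⊕w  = ⊥-elim (w⋠u (≼-trans (y≼x⊕y u w)
                        (u-max (u ⊕ w) (Idempotent-⊕ idem-u idem-w , z⋠u⊕w) (x≼x⊕y u w))))

    ↓u-maximal : ↓-Maximal u
    ↓u-maximal J isIdeal J∌𝟙 ↓u⊆J y Jy with y ≼? u | idempotent-multiple y
    ... | yes y≼u | _                  = y≼u
    ... | no y⋠u  | k , idem-v , y≼k·y =
      ⊥-elim (z⋠u (≼-idempotent-cases idem-v (z≼u⊕ idem-v k·y⋠u)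
                                             (z≼u⊕ (Idempotent-neg idem-v) neg-k·y⋠u)))
      where
      open IsIdeal isIdeal
      k·y⋠u : ¬ k · y ≼ u
      k·y⋠u k·y≼u = y⋠u (≼-trans y≼k·y k·y≼u)
      neg-k·y⋠u : ¬ neg (k · y) ≼ u
      neg-k·y⋠u neg-k·y≼u = J∌𝟙 (∈-resp-≈ (⊕-inverseʳ _) (⊕∈ (·∈ k Jy) (↓u⊆J _ neg-k·y≼u)))

module QuotientIdeals {c ℓ p} (A : MVAlgebra c ℓ) {I : MVAlgebra.Carrier A → Set p}
  (isIdeal-I : MVProperties.IsIdeal A I) where
  open MVProperties A
  open Quotient isIdeal-I using (quotient; ≈⇒~)
  module A/I = MVProperties quotient

  ≼⇒≼/ : ∀ {x y} → x ≼ y → x A/I.≼ y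
  ≼⇒≼/ (t , x⊕t≈y) = t , ≈⇒~ x⊕t≈y

  IsIdeal-quotient : ∀ {q} {K : Carrier → Set q} → IsIdeal K → (∀ x → I x → K x) → A/I.IsIdeal K
  IsIdeal-quotient {K = K} isIdeal-K I⊆K = record { z∈ = z∈ ; ⊕∈ = ⊕∈ ; ↓∈ = ↓∈/ }
    where
    open IsIdeal isIdeal-K
    ↓∈/ : ∀ {x y} → y A/I.≼ x → K x → K y
    ↓∈/ {x} {y} (t , y⊕t~x) Kx = ↓∈ y≼x⊕dist (⊕∈ Kx (I⊆K _ y⊕t~x))
      where
      y≼x⊕dist : y ≼ x ⊕ dist (y ⊕ t) x
      y≼x⊕dist = ≼-trans (x≼x⊕y y t)
        (≼-trans (x≼y⊕[x⊖y] (y ⊕ t) x) (⊕-mono-≼ ≼-refl (x≼x⊕y _ _)))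

  ∈-antimono-≤/ : ∀ {x y} → y A/I.≤ x → I x → I y
  ∈-antimono-≤/ y≤x = A/I.IsIdeal.↓∈ (IsIdeal-quotient isIdeal-I (λ _ Ix → Ix)) (A/I.≤⇒≼ y≤x)

module RadicalCompletion {c ℓ} (A : MVAlgebra c ℓ) where
  open MVProperties A

  isIdeal : (I : Ideal structure) → IsIdeal (mem I)
  isIdeal I = record { z∈ = 𝟘∈ I ; ⊕∈ = ⊕-closed I _ _ ; ↓∈ = λ y≼x → ↓-closed I _ _ (≼⇒≤ y≼x) }

  ≈⇒Rad-dist : ∀ {x y} → x ≈ y → Rad structure (dist x y)
  ≈⇒Rad-dist x≈y M _ = Quotient.≈⇒~ (isIdeal M) x≈y

  isIdeal/Rad : (J : Ideal (A /Rad)) → IsIdeal (mem J)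
  isIdeal/Rad J = record
    { z∈ = 𝟘∈ J ; ⊕∈ = ⊕-closed J _ _ ; ↓∈ = λ y≼x → ↓-closed J _ _ (≈⇒Rad-dist (≼⇒≤ y≼x)) }

  module FiniteQuotient (I : Ideal structure) (n : ℕ) (f : Fin n → Carrier)
    (f-surjective : ∀ x → ∃ λ i → mem I (dist (f i) x))
    (f-injective : ∀ i j → mem I (dist (f i) (f j)) → i ≡ j) where
    open Quotient (isIdeal I) using (quotient; ~𝟘⇒∈; ∈⇒~𝟘)
    open QuotientIdeals A (isIdeal I)
    open FiniteMVProperties quotient n f f-surjective f-injective

    ↓ᴵ : ∀ {u} → A/I.Idempotent u → Ideal structure
    ↓ᴵ {u} idem-u = record
      { mem      = λ y → y A/I.≤ u
      ; 𝟘∈       = A/I.≼⇒≤ (A/I.≼-minimum u)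
      ; ⊕-closed = λ _ _ x≤u y≤u →
          A/I.≼⇒≤ (A/I.≼-respʳ-≈ idem-u (A/I.⊕-mono-≼ (A/I.≤⇒≼ x≤u) (A/I.≤⇒≼ y≤u)))
      ; ↓-closed = λ _ _ y≤x x≤u → A/I.≼⇒≤ (A/I.≼-trans (≼⇒≼/ (≤⇒≼ y≤x)) (A/I.≤⇒≼ x≤u)) }

    ↓ᴵ-maximal : ∀ {u} (idem-u : A/I.Idempotent u) → ¬ 𝟙 A/I.≼ u → ↓-Maximal u →
                 Maximal structure (↓ᴵ idem-u)
    ↓ᴵ-maximal {u} idem-u 𝟙⋠u ↓u-maximal = 𝟙⋠u ∘ A/I.≤⇒≼ , ↓ᴵ-above
      where
      ↓ᴵ-above : ∀ J → Proper structure J →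
                 _⊆ᴵ_ structure (↓ᴵ idem-u) J → _⊆ᴵ_ structure J (↓ᴵ idem-u)
      ↓ᴵ-above J J∌𝟙 ↓u⊆J y Jy =
        A/I.≼⇒≤ (↓u-maximal (mem J) isIdeal/-J J∌𝟙 (λ x x≼u → ↓u⊆J x (A/I.≼⇒≤ x≼u)) y Jy)
        where
        I⊆J : ∀ x → mem I x → mem J x
        I⊆J x Ix = ↓u⊆J x (A/I.≼⇒≤ (A/I.≼-trans (A/I.≼-reflexive (∈⇒~𝟘 Ix)) (A/I.≼-minimum u)))
        isIdeal/-J : A/I.IsIdeal (mem J)
        isIdeal/-J = IsIdeal-quotient (isIdeal J) I⊆J

    maximal-ideal-avoiding : ∀ {z} → ¬ z A/I.≈ 𝟘 →
                             Σ (Ideal structure) λ M → Maximal structure M × ¬ mem M z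
    maximal-ideal-avoiding {z} z≁𝟘 =
      let u , idem-u , z⋠u , ↓u-maximal = maximal-principal-ideal-avoiding z≁𝟘 in
      ↓ᴵ idem-u
      , ↓ᴵ-maximal idem-u (λ 𝟙≼u → z⋠u (A/I.≼-trans (A/I.≼-maximum z) 𝟙≼u)) ↓u-maximal
      , z⋠u ∘ A/I.≤⇒≼

    Rad⊆ : ∀ x → Rad structure x → mem I x
    Rad⊆ x x∈Rad with x ≟ 𝟘
    ... | yes x~𝟘 = ~𝟘⇒∈ x~𝟘
    ... | no x≁𝟘  = let M , M-maximal , x∉M = maximal-ideal-avoiding x≁𝟘 in
                    ⊥-elim (x∉M (x∈Rad M M-maximal))

  Rad⊆ : (I : FinIdeal structure) → ∀ x → Rad structure x → mem (ideal structure I) x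
  Rad⊆ (I , n , f , f-surjective , f-injective) = FiniteQuotient.Rad⊆ I n f f-surjective f-injective

  -- Rad(A) ⊆ I makes the order of A/Rad(A) coincide with that of A/I.
  toRadIdeal : FinIdeal structure → FinIdeal (A /Rad)
  toRadIdeal I@(I₀ , n , f , f-surjective , f-injective) =
    record
      { mem      = λ x → Lift (c ⊔ lsuc ℓ) (mem I₀ x)
      ; 𝟘∈       = lift (𝟘∈ I₀)
      ; ⊕-closed = λ x y Ix Iy → lift (⊕-closed I₀ x y (lower Ix) (lower Iy))
      ; ↓-closed = λ x y y≤x Ix → lift (∈-antimono-≤/ (Rad⊆ I _ y≤x) (lower Ix)) }
    , n , f , (λ x → proj₁ (f-surjective x) , lift (proj₂ (f-surjective x)))
    , (λ i j fi~fj → f-injective i j (lower fi~fj))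
    where open QuotientIdeals A (isIdeal I₀)

  -- A/Rad-ideals live one universe up; membership is brought back down through the decidable
  -- equality of indices in the finite quotient.
  module FromRadIdeal (J : Ideal (A /Rad)) (n : ℕ) (f : Fin n → Carrier)
    (f-surjective : ∀ x → ∃ λ i → mem J (dist (f i) x))
    (f-injective : ∀ i j → mem J (dist (f i) (f j)) → i ≡ j) where
    open Quotient (isIdeal/Rad J) using (quotient; ~𝟘⇒∈; ∈⇒~𝟘)
    open FiniteMVProperties quotient n f f-surjective f-injective
    open IsIdeal (isIdeal/Rad J)

    J↓ : Carrier → Set ℓ
    J↓ x = Lift ℓ (index x ≡ index 𝟘)

    J↓⇒J : ∀ {x} → J↓ x → mem J x
    J↓⇒J same-index = ~𝟘⇒∈ (index-injective (lower same-index))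

    J⇒J↓ : ∀ {x} → mem J x → J↓ x
    J⇒J↓ Jx = lift (index-cong (∈⇒~𝟘 Jx))

    fromRadIdeal : FinIdeal structure
    fromRadIdeal =
      record
        { mem      = J↓
        ; 𝟘∈       = lift refl
        ; ⊕-closed = λ _ _ Jx Jy → J⇒J↓ (⊕∈ (J↓⇒J Jx) (J↓⇒J Jy))
        ; ↓-closed = λ _ _ y≤x Jx → J⇒J↓ (↓∈ (≤⇒≼ y≤x) (J↓⇒J Jx)) }
      , n , f , (λ x → proj₁ (f-surjective x) , J⇒J↓ (proj₂ (f-surjective x)))
      , (λ i j fi~fj → f-injective i j (J↓⇒J fi~fj))

  fromRadIdeal : FinIdeal (A /Rad) → FinIdeal structure
  fromRadIdeal (J , n , f , f-surjective , f-injective) =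
    FromRadIdeal.fromRadIdeal J n f f-surjective f-injective

  fromRadIdeal-⊆ : ∀ J x → mem (ideal structure (fromRadIdeal J)) x → mem (ideal (A /Rad) J) x
  fromRadIdeal-⊆ (J , n , f , f-surjective , f-injective) _ =
    FromRadIdeal.J↓⇒J J n f f-surjective f-injective

  ⊆-fromRadIdeal : ∀ J x → mem (ideal (A /Rad) J) x → mem (ideal structure (fromRadIdeal J)) x
  ⊆-fromRadIdeal (J , n , f , f-surjective , f-injective) _ =
    FromRadIdeal.J⇒J↓ J n f f-surjective f-injective

  restrict : Profinite (A /Rad) → Profinite structure
  restrict x = record
    { fam    = λ I → fam x (toRadIdeal I)
    ; compat = λ I I' I⊆I' →
        lower (compat x (toRadIdeal I) (toRadIdeal I') (λ y Iy → lift (I⊆I' y (lower Iy)))) }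

  extend : Profinite structure → Profinite (A /Rad)
  extend y = record
    { fam    = λ J → fam y (fromRadIdeal J)
    ; compat = λ J J' J⊆J' → fromRadIdeal-⊆ J' _
        (compat y (fromRadIdeal J) (fromRadIdeal J')
          (λ z Jz → ⊆-fromRadIdeal J' z (J⊆J' z (fromRadIdeal-⊆ J z Jz)))) }

  ⊆-toRadIdeal-fromRadIdeal : ∀ J →
    _⊆ᴵ_ (A /Rad) (ideal (A /Rad) J) (ideal (A /Rad) (toRadIdeal (fromRadIdeal J)))
  ⊆-toRadIdeal-fromRadIdeal J z Jz = lift (⊆-fromRadIdeal J z Jz)

  restrict-injective : ∀ x y → _≈̂_ structure (restrict x) (restrict y) → _≈̂_ (A /Rad) x y
  restrict-injective x y x≈y J = fromRadIdeal-⊆ J _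
    (~-trans (lower (compat x J J↑ (⊆-toRadIdeal-fromRadIdeal J)))
      (~-trans (x≈y (fromRadIdeal J)) (~-sym (lower (compat y J J↑ (⊆-toRadIdeal-fromRadIdeal J))))))
    where
    J↑ : FinIdeal (A /Rad)
    J↑ = toRadIdeal (fromRadIdeal J)
    open Quotient (isIdeal (ideal structure (fromRadIdeal J))) using (~-trans; ~-sym)

  restrict-extend : ∀ y → _≈̂_ structure (restrict (extend y)) y
  restrict-extend y I = compat y (fromRadIdeal (toRadIdeal I)) I
    (λ z Jz → lower (fromRadIdeal-⊆ (toRadIdeal I) z Jz))

proposition3p1 : ∀ {c ℓ} (A : MVAlgebra c ℓ) → ProfiniteIso (A /Rad) (MVAlgebra.structure A)
proposition3p1 A = record
  { to         = restrict
  ; to-cong    = λ x y x≈y I → lower (x≈y (toRadIdeal I))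
  ; injective  = restrict-injective
  ; surjective = λ y → extend y , restrict-extend y
  ; pres-⊕     = λ x y z x⊕y≈z I → lower (x⊕y≈z (toRadIdeal I))
  ; pres-neg   = λ x z negx≈z I → lower (negx≈z (toRadIdeal I))
  ; pres-𝟘     = λ z z≈𝟘 I → lower (z≈𝟘 (toRadIdeal I)) }
  where open RadicalCompletion A
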